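{- Let $d\ge 1$. Draw coupons independently and uniformly at random (with replacement) from $d$ types, and let $T$ be the first draw at which every one of the $d$ types has been obtained at least once. Let $J$ be the number of types obtained exactly once among the first $T$ draws. Then $\mathbb{E}[J]=H_d=1+\frac12+\dots+\frac1d$. -}

module Defs where

open import Data.Nat as ℕ using (ℕ; zero; suc)
open import Data.Fin using (Fin)
open import Data.Fin.Properties using (_≟_)
open import Data.List using (List; []; _∷_; map; concatMap; length; filter; take; upTo; allFin; foldr)
open import Data.List.Relation.Unary.All using (All)
open import Data.List.Relation.Unary.All.Properties using ()
open import Data.List.Relation.Unary.All using (all?)
open import Data.List.Membership.DecPropositional using ()
open import Data.Maybe using (Maybe; just; nothing)
open import Data.Integer using (+_)
open import Data.Rational using (ℚ; _/_; _+_; _*_; 0ℚ; 1ℚ)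
open import Relation.Nullary using (Dec; yes; no)
open import Relation.Nullary.Decidable using (does)

words : (d n : ℕ) → List (List (Fin d))
words d zero    = [] ∷ []
words d (suc n) = concatMap (λ w → map (λ i → i ∷ w) (allFin d)) (words d n)

count : ∀ {d} → Fin d → List (Fin d) → ℕ
count i w = length (filter (λ j → i ≟ j) w)

covers : ∀ {d} → List (Fin d) → Set
covers {d} w = All (λ i → 1 ℕ.≤ count i w) (allFin d)

covers? : ∀ {d} (w : List (Fin d)) → Dec (covers w)
covers? {d} w = all? (λ i → 1 ℕ.≤? count i w) (allFin d)

firstCover : ∀ {d} → List (Fin d) → List ℕ → Maybe (List (Fin d))
firstCover w []       = nothing
firstCover w (k ∷ ks) with covers? (take k w)
... | yes _ = just (take k w)
... | no  _ = firstCover w ks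

-- the prefix w₁…w_T, where T is the first draw at which all types have
-- appeared; nothing if T > length w
prefixT : ∀ {d} → List (Fin d) → Maybe (List (Fin d))
prefixT w = firstCover w (upTo (suc (length w)))

singles : ∀ {d} → List (Fin d) → ℕ
singles {d} w = length (filter (λ i → count i w ℕ.≟ 1) (allFin d))

-- J · 1{T ≤ n} evaluated on a word of length n
JT : ∀ {d} → List (Fin d) → ℕ
JT w with prefixT w
... | just p  = singles p
... | nothing = 0

ℕtoℚ : ℕ → ℚ
ℕtoℚ m = + m / 1

-- 1/m (only used for m ≥ 1; value 0 at m = 0 is a dummy)
recip : ℕ → ℚ
recip zero    = 0ℚ
recip (suc k) = + 1 / suc k

_^ℚ_ : ℚ → ℕ → ℚ
q ^ℚ zero  = 1ℚ
q ^ℚ suc n = q * (q ^ℚ n)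

sumℚ : List ℚ → ℚ
sumℚ = foldr _+_ 0ℚ

-- E[ J · 1{T ≤ n} ] : average of JT over the d^n equally likely words
-- of length n (each has probability (1/d)^n)
truncatedExpectation : (d n : ℕ) → ℚ
truncatedExpectation d n =
  sumℚ (map (λ w → ℕtoℚ (JT w) * (recip d ^ℚ n)) (words d n))

harmonic : ℕ → ℚ
harmonic zero    = 0ℚ
harmonic (suc d) = harmonic d + recip (suc d)

{-# OPTIONS --safe #-}
module Submission where

-- Let z ≥ 1 types be missing from the draws p so far and s types be drawn exactly once. Then
-- E[J | p] = s/(z+1) + H_z (the potential): a current singleton stays one iff it is not drawn
-- again before all z missing types appear, which has probability 1/(z+1), and the k-th last
-- new type stays a singleton with probability 1/k. Frozen at the covering time T, the potential
-- becomes a martingale, so its average over the d^n words of length n is its value H_d at the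
-- empty word. It differs from J·1{T ≤ n} only on words that do not cover yet, where it is at
-- most 2d times the number of missing types; that number averages d(1 - 1/d)^n, and
-- (1 - 1/d)^n (d - 1 + n) ≤ d - 1, so the error is O(1/n).

open import Defs
open import Algebra.Bundles using (CommutativeMonoid)
open import Data.Fin using (Fin; zero; suc)
open import Data.Fin.Properties using (_≟_; suc-injective)
import Data.Integer as ℤ
import Data.Integer.Properties as ℤP
open import Data.List using (List; []; _∷_; _++_; _∷ʳ_; map; concatMap; length; filter; take; upTo; allFin; tabulate)
import Data.List.Properties as ListP
open import Data.List.Relation.Unary.All using (All; []; _∷_)
open import Data.List.Relation.Unary.All.Properties using (applyUpTo⁺₁)
open import Data.Maybe using (Maybe; just; nothing; maybe′; _<∣>_)
open import Data.Nat as ℕ using (ℕ; zero; suc; z≤n; s≤s)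
import Data.Nat.Properties as ℕP
open import Data.Nat.Coprimality using (1-coprimeTo) renaming (sym to coprime-sym)
open import Data.Nat.Tactic.RingSolver using () renaming (solve-∀ to ℕ-solve-∀)
open import Data.Product using (∃-syntax; _,_)
open import Data.Rational as ℚ using (ℚ; mkℚ; 0ℚ; 1ℚ; _+_; _*_; -_; _-_; ∣_∣; _≤_; _<_)
import Data.Rational.Properties as ℚP
open import Algebra.Properties.CommutativeSemigroup (CommutativeMonoid.commutativeSemigroup ℚP.+-0-commutativeMonoid) using () renaming (interchange to +-interchange)
open import Algebra.Properties.CommutativeSemigroup (CommutativeMonoid.commutativeSemigroup ℚP.*-1-commutativeMonoid) using () renaming (interchange to *-interchange)
open import Algebra.Properties.CommutativeSemigroup ℕP.+-commutativeSemigroup using () renaming (interchange to ℕ-+-interchange)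
open import Function using (_∘_; id)
open import Relation.Binary.PropositionalEquality
open import Relation.Nullary using (Dec; yes; no; ¬_; contradiction)
open import Relation.Nullary.Decidable using (dec⇒maybe)
open import Tactic.RingSolver using (solve-∀)
open import Tactic.RingSolver.Core.AlmostCommutativeRing using (AlmostCommutativeRing; fromCommutativeRing)

-- Without the zero test the solver keeps zero coefficients in its normal forms and refl fails.
ℚ-ring : AlmostCommutativeRing _ _
ℚ-ring = fromCommutativeRing ℚP.+-*-commutativeRing (λ x → dec⇒maybe (0ℚ ℚP.≟ x))

*-monoˡ-≤-0≤ : ∀ {p q} r → 0ℚ ≤ r → p ≤ q → r * p ≤ r * q
*-monoˡ-≤-0≤ r 0≤r = ℚP.*-monoˡ-≤-nonNeg r {{ℚ.nonNegative 0≤r}}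

*-monoʳ-≤-0≤ : ∀ {p q} r → 0ℚ ≤ r → p ≤ q → p * r ≤ q * r
*-monoʳ-≤-0≤ r 0≤r = ℚP.*-monoʳ-≤-nonNeg r {{ℚ.nonNegative 0≤r}}

0≤* : ∀ {p q} → 0ℚ ≤ p → 0ℚ ≤ q → 0ℚ ≤ p * q
0≤* {p} {q} 0≤p 0≤q = subst (_≤ p * q) (ℚP.*-zeroˡ q) (*-monoʳ-≤-0≤ q 0≤q 0≤p)

0≤+ : ∀ {p q} → 0ℚ ≤ p → 0ℚ ≤ q → 0ℚ ≤ p + q
0≤+ 0≤p 0≤q = ℚP.+-mono-≤ 0≤p 0≤q

0≤^ℚ : ∀ {q} n → 0ℚ ≤ q → 0ℚ ≤ q ^ℚ n
0≤^ℚ zero    _   = ℚ.*≤* (ℤ.+≤+ z≤n)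
0≤^ℚ (suc n) 0≤q = 0≤* 0≤q (0≤^ℚ n 0≤q)

ℕtoℚ≡mkℚ : ∀ n → ℕtoℚ n ≡ mkℚ (ℤ.+ n) 0 (coprime-sym (1-coprimeTo n))
ℕtoℚ≡mkℚ n = ℚP.normalize-coprime (coprime-sym (1-coprimeTo n))

ℕtoℚ-+ : ∀ m n → ℕtoℚ (m ℕ.+ n) ≡ ℕtoℚ m + ℕtoℚ n
ℕtoℚ-+ m n rewrite ℕtoℚ≡mkℚ m | ℕtoℚ≡mkℚ n =
  cong (λ k → k ℚ./ 1) (cong₂ ℤ._+_ (sym (ℤP.*-identityʳ (ℤ.+ m))) (sym (ℤP.*-identityʳ (ℤ.+ n))))

ℕtoℚ-* : ∀ m n → ℕtoℚ (m ℕ.* n) ≡ ℕtoℚ m * ℕtoℚ n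
ℕtoℚ-* m n rewrite ℕtoℚ≡mkℚ m | ℕtoℚ≡mkℚ n = cong (λ k → k ℚ./ 1) (ℤP.pos-* m n)

ℕtoℚ-suc : ∀ n → ℕtoℚ (suc n) ≡ 1ℚ + ℕtoℚ n
ℕtoℚ-suc = ℕtoℚ-+ 1

ℕtoℚ-mono-≤ : ∀ {m n} → m ℕ.≤ n → ℕtoℚ m ≤ ℕtoℚ n
ℕtoℚ-mono-≤ {m} {n} m≤n rewrite ℕtoℚ≡mkℚ m | ℕtoℚ≡mkℚ n =
  ℚ.*≤* (subst₂ ℤ._≤_ (sym (ℤP.*-identityʳ (ℤ.+ m))) (sym (ℤP.*-identityʳ (ℤ.+ n))) (ℤ.+≤+ m≤n))

ℕtoℚ-mono-< : ∀ {m n} → m ℕ.< n → ℕtoℚ m < ℕtoℚ n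
ℕtoℚ-mono-< {m} {n} m<n rewrite ℕtoℚ≡mkℚ m | ℕtoℚ≡mkℚ n =
  ℚ.*<* (subst₂ ℤ._<_ (sym (ℤP.*-identityʳ (ℤ.+ m))) (sym (ℤP.*-identityʳ (ℤ.+ n))) (ℤ.+<+ m<n))

0≤ℕtoℚ : ∀ n → 0ℚ ≤ ℕtoℚ n
0≤ℕtoℚ n = ℕtoℚ-mono-≤ {0} {n} z≤n

ℕtoℚ-*-∸1 : ∀ n → ℕtoℚ n * ℕtoℚ (n ℕ.∸ 1) ≡ ℕtoℚ n * (ℕtoℚ n - 1ℚ)
ℕtoℚ-*-∸1 zero    = refl
ℕtoℚ-*-∸1 (suc n) = cong (ℕtoℚ (suc n) *_) (trans (x≡1+x-1 (ℕtoℚ n)) (cong (_- 1ℚ) (sym (ℕtoℚ-suc n))))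
  where
  x≡1+x-1 : ∀ x → x ≡ 1ℚ + x - 1ℚ
  x≡1+x-1 = solve-∀ ℚ-ring

recip≡mkℚ : ∀ k → recip (suc k) ≡ mkℚ (ℤ.+ 1) k (1-coprimeTo (suc k))
recip≡mkℚ k = ℚP.normalize-coprime (1-coprimeTo (suc k))

recip-inverseˡ : ∀ k → recip (suc k) * ℕtoℚ (suc k) ≡ 1ℚ
recip-inverseˡ k rewrite recip≡mkℚ k | ℕtoℚ≡mkℚ (suc k) =
  ℚP.*-inverseˡ (mkℚ (ℤ.+ suc k) 0 (coprime-sym (1-coprimeTo (suc k))))

0≤recip : ∀ k → 0ℚ ≤ recip k
0≤recip zero    = ℚP.≤-refl
0≤recip (suc k) rewrite recip≡mkℚ k = ℚ.*≤* (ℤ.+≤+ z≤n)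

recip≤1 : ∀ k → recip k ≤ 1ℚ
recip≤1 zero    = ℚ.*≤* (ℤ.+≤+ z≤n)
recip≤1 (suc k) rewrite recip≡mkℚ k = ℚ.*≤* (ℤ.+≤+ (s≤s z≤n))

recip^n*d^n≡1 : ∀ a n → recip (suc a) ^ℚ n * ℕtoℚ (suc a ℕ.^ n) ≡ 1ℚ
recip^n*d^n≡1 a zero    = ℚP.*-identityˡ 1ℚ
recip^n*d^n≡1 a (suc n) = begin
    recip (suc a) * recip (suc a) ^ℚ n * ℕtoℚ (suc a ℕ.* suc a ℕ.^ n)
  ≡⟨ cong (recip (suc a) * recip (suc a) ^ℚ n *_) (ℕtoℚ-* (suc a) (suc a ℕ.^ n)) ⟩
    recip (suc a) * recip (suc a) ^ℚ n * (ℕtoℚ (suc a) * ℕtoℚ (suc a ℕ.^ n))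
  ≡⟨ *-interchange (recip (suc a)) (recip (suc a) ^ℚ n) (ℕtoℚ (suc a)) (ℕtoℚ (suc a ℕ.^ n)) ⟩
    recip (suc a) * ℕtoℚ (suc a) * (recip (suc a) ^ℚ n * ℕtoℚ (suc a ℕ.^ n))
  ≡⟨ cong₂ _*_ (recip-inverseˡ a) (recip^n*d^n≡1 a n) ⟩
    1ℚ
  ∎
  where open ≡-Reasoning

0≤harmonic : ∀ n → 0ℚ ≤ harmonic n
0≤harmonic zero    = ℚP.≤-refl
0≤harmonic (suc n) = 0≤+ (0≤harmonic n) (0≤recip (suc n))

harmonic≤ℕtoℚ : ∀ n → harmonic n ≤ ℕtoℚ n
harmonic≤ℕtoℚ zero    = ℚP.≤-refl
harmonic≤ℕtoℚ (suc n) = subst (harmonic (suc n) ≤_) (trans (ℚP.+-comm (ℕtoℚ n) 1ℚ) (sym (ℕtoℚ-suc n)))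
  (ℚP.+-mono-≤ (harmonic≤ℕtoℚ n) (recip≤1 (suc n)))

archimedean : ∀ {ε} → 0ℚ < ε → ∃[ q ] 1ℚ ≤ ε * ℕtoℚ (suc q)
archimedean {mkℚ (ℤ.+ 0) _ _}      (ℚ.*<* 0<0) = contradiction 0<0 (ℤP.<-irrefl refl)
archimedean {mkℚ ℤ.-[1+ _ ] _ _} (ℚ.*<* ())
archimedean {ε@(mkℚ ℤ.+[1+ p ] q _)} _ =
  q , subst (_≤ ε * ℕtoℚ (suc q)) (recip-inverseˡ q) (*-monoʳ-≤-0≤ (ℕtoℚ (suc q)) (0≤ℕtoℚ (suc q)) 1/[1+q]≤ε)
  where
  1/[1+q]≤ε : recip (suc q) ≤ ε
  1/[1+q]≤ε rewrite recip≡mkℚ q = ℚ.*≤* (subst₂ ℤ._≤_ (ℤP.pos-* 1 (suc q)) (ℤP.pos-* (suc p) (suc q))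
    (ℤ.+≤+ (ℕP.*-monoˡ-≤ (suc q) {1} {suc p} (s≤s z≤n))))

O[1/n]⇒eventually< : ∀ (e : ℕ → ℚ) c K → (∀ n → e n * ℕtoℚ (c ℕ.+ n) ≤ ℕtoℚ K) →
  ∀ ε → 0ℚ < ε → ∃[ N ] ((n : ℕ) → N ℕ.≤ n → e n < ε)
O[1/n]⇒eventually< e c K bound ε 0<ε with archimedean 0<ε
... | q , 1≤ε[1+q] = N , e<ε
  where
  N = suc q ℕ.* suc K
  e<ε : ∀ n → N ℕ.≤ n → e n < ε
  e<ε n N≤n = ℚP.*-cancelʳ-<-nonNeg (ℕtoℚ (c ℕ.+ n)) {{ℚ.nonNegative (0≤ℕtoℚ (c ℕ.+ n))}} (begin-strict
      e n * ℕtoℚ (c ℕ.+ n)               ≤⟨ bound n ⟩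
      ℕtoℚ K                             <⟨ ℕtoℚ-mono-< (ℕP.n<1+n K) ⟩
      ℕtoℚ (suc K)                       ≡⟨ sym (ℚP.*-identityˡ (ℕtoℚ (suc K))) ⟩
      1ℚ * ℕtoℚ (suc K)                  ≤⟨ *-monoʳ-≤-0≤ (ℕtoℚ (suc K)) (0≤ℕtoℚ (suc K)) 1≤ε[1+q] ⟩
      ε * ℕtoℚ (suc q) * ℕtoℚ (suc K)    ≡⟨ ℚP.*-assoc ε (ℕtoℚ (suc q)) (ℕtoℚ (suc K)) ⟩
      ε * (ℕtoℚ (suc q) * ℕtoℚ (suc K))  ≡⟨ cong (ε *_) (sym (ℕtoℚ-* (suc q) (suc K))) ⟩
      ε * ℕtoℚ N                         ≤⟨ *-monoˡ-≤-0≤ ε (ℚP.<⇒≤ 0<ε) (ℕtoℚ-mono-≤ (ℕP.≤-trans N≤n (ℕP.m≤n+m n c))) ⟩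
      ε * ℕtoℚ (c ℕ.+ n)                 ∎)
    where open ℚP.≤-Reasoning

a^n*[a+n]≤[1+a]^n*a : ∀ a n → a ℕ.^ n ℕ.* (a ℕ.+ n) ℕ.≤ suc a ℕ.^ n ℕ.* a
a^n*[a+n]≤[1+a]^n*a a zero    = ℕP.≤-reflexive (cong (1 ℕ.*_) (ℕP.+-identityʳ a))
a^n*[a+n]≤[1+a]^n*a a (suc n) = begin
    a ℕ.* a ℕ.^ n ℕ.* (a ℕ.+ suc n)                        ≡⟨ cong (a ℕ.* a ℕ.^ n ℕ.*_) (ℕP.+-suc a n) ⟩
    a ℕ.* a ℕ.^ n ℕ.* suc (a ℕ.+ n)                        ≡⟨ split a (a ℕ.^ n) n ⟩
    a ℕ.* (a ℕ.^ n ℕ.* (a ℕ.+ n)) ℕ.+ a ℕ.* a ℕ.^ n        ≤⟨ ℕP.+-mono-≤ (ℕP.*-monoʳ-≤ a (a^n*[a+n]≤[1+a]^n*a a n))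
                                                                         (ℕP.*-monoʳ-≤ a (ℕP.^-monoˡ-≤ n (ℕP.n≤1+n a))) ⟩
    a ℕ.* (suc a ℕ.^ n ℕ.* a) ℕ.+ a ℕ.* suc a ℕ.^ n        ≡⟨ merge a (suc a ℕ.^ n) ⟩
    suc a ℕ.* suc a ℕ.^ n ℕ.* a                            ∎
  where
  open ℕP.≤-Reasoning
  split : ∀ a P n → a ℕ.* P ℕ.* suc (a ℕ.+ n) ≡ a ℕ.* (P ℕ.* (a ℕ.+ n)) ℕ.+ a ℕ.* P
  split = ℕ-solve-∀
  merge : ∀ a Q → a ℕ.* (Q ℕ.* a) ℕ.+ a ℕ.* Q ≡ suc a ℕ.* Q ℕ.* a
  merge = ℕ-solve-∀

private variable
  A B : Set

Σ : (A → ℚ) → List A → ℚ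
Σ f l = sumℚ (map f l)

sumℕ : (A → ℕ) → List A → ℕ
sumℕ f []      = 0
sumℕ f (x ∷ l) = f x ℕ.+ sumℕ f l

Σ-cong : ∀ {f g : A → ℚ} l → (∀ x → f x ≡ g x) → Σ f l ≡ Σ g l
Σ-cong []      f≡g = refl
Σ-cong (x ∷ l) f≡g = cong₂ _+_ (f≡g x) (Σ-cong l f≡g)

Σ-mono-≤ : ∀ {f g : A → ℚ} l → (∀ x → f x ≤ g x) → Σ f l ≤ Σ g l
Σ-mono-≤ []      f≤g = ℚP.≤-refl
Σ-mono-≤ (x ∷ l) f≤g = ℚP.+-mono-≤ (f≤g x) (Σ-mono-≤ l f≤g)

0≤Σ : ∀ {f : A → ℚ} l → (∀ x → 0ℚ ≤ f x) → 0ℚ ≤ Σ f l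
0≤Σ []      0≤f = ℚP.≤-refl
0≤Σ (x ∷ l) 0≤f = 0≤+ (0≤f x) (0≤Σ l 0≤f)

Σ-+ : ∀ (f g : A → ℚ) l → Σ (λ x → f x + g x) l ≡ Σ f l + Σ g l
Σ-+ f g []      = refl
Σ-+ f g (x ∷ l) = trans (cong ((f x + g x) +_) (Σ-+ f g l)) (+-interchange (f x) (g x) (Σ f l) (Σ g l))

Σ-*ʳ : ∀ (f : A → ℚ) c l → Σ (λ x → f x * c) l ≡ Σ f l * c
Σ-*ʳ f c []      = sym (ℚP.*-zeroˡ c)
Σ-*ʳ f c (x ∷ l) = trans (cong (f x * c +_) (Σ-*ʳ f c l)) (sym (ℚP.*-distribʳ-+ c (f x) (Σ f l)))

Σ-const : ∀ c (l : List A) → Σ (λ _ → c) l ≡ c * ℕtoℚ (length l)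
Σ-const c []      = sym (ℚP.*-zeroʳ c)
Σ-const c (x ∷ l) = begin
    c + Σ (λ _ → c) l              ≡⟨ cong (c +_) (Σ-const c l) ⟩
    c + c * ℕtoℚ (length l)        ≡⟨ cong (_+ c * ℕtoℚ (length l)) (ℚP.*-identityʳ c) ⟨
    c * 1ℚ + c * ℕtoℚ (length l)   ≡⟨ ℚP.*-distribˡ-+ c 1ℚ (ℕtoℚ (length l)) ⟨
    c * (1ℚ + ℕtoℚ (length l))     ≡⟨ cong (c *_) (sym (ℕtoℚ-suc (length l))) ⟩
    c * ℕtoℚ (suc (length l))      ∎
  where open ≡-Reasoning

Σ-ℕtoℚ : ∀ (f : A → ℕ) l → Σ (λ x → ℕtoℚ (f x)) l ≡ ℕtoℚ (sumℕ f l)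
Σ-ℕtoℚ f []      = refl
Σ-ℕtoℚ f (x ∷ l) = trans (cong (ℕtoℚ (f x) +_) (Σ-ℕtoℚ f l)) (sym (ℕtoℚ-+ (f x) (sumℕ f l)))

Σ-ℕtoℚ-*ʳ : ∀ (f : A → ℕ) c l → Σ (λ x → ℕtoℚ (f x) * c) l ≡ ℕtoℚ (sumℕ f l) * c
Σ-ℕtoℚ-*ʳ f c l = trans (Σ-*ʳ (ℕtoℚ ∘ f) c l) (cong (_* c) (Σ-ℕtoℚ f l))

Σ-++ : ∀ (f : A → ℚ) xs ys → Σ f (xs ++ ys) ≡ Σ f xs + Σ f ys
Σ-++ f []       ys = sym (ℚP.+-identityˡ (Σ f ys))
Σ-++ f (x ∷ xs) ys = trans (cong (f x +_) (Σ-++ f xs ys)) (sym (ℚP.+-assoc (f x) (Σ f xs) (Σ f ys)))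

Σ-map : ∀ (f : B → ℚ) (g : A → B) l → Σ f (map g l) ≡ Σ (f ∘ g) l
Σ-map f g l = cong sumℚ (sym (ListP.map-∘ l))

Σ-concatMap : ∀ (f : B → ℚ) (g : A → List B) l → Σ f (concatMap g l) ≡ Σ (λ x → Σ f (g x)) l
Σ-concatMap f g []      = refl
Σ-concatMap f g (x ∷ l) = trans (Σ-++ f (g x) (concatMap g l)) (cong (Σ f (g x) +_) (Σ-concatMap f g l))

Σ-swap : ∀ (h : A → B → ℚ) (xs : List A) ys →
  Σ (λ y → Σ (λ x → h x y) xs) ys ≡ Σ (λ x → Σ (λ y → h x y) ys) xs
Σ-swap h xs []       = sym (trans (Σ-const 0ℚ xs) (ℚP.*-zeroˡ (ℕtoℚ (length xs))))
Σ-swap h xs (y ∷ ys) = trans (cong (Σ (λ x → h x y) xs +_) (Σ-swap h xs ys))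
  (sym (Σ-+ (λ x → h x y) (λ x → Σ (h x) ys) xs))

sumℕ-cong : ∀ {f g : A → ℕ} l → (∀ x → f x ≡ g x) → sumℕ f l ≡ sumℕ g l
sumℕ-cong []      f≡g = refl
sumℕ-cong (x ∷ l) f≡g = cong₂ ℕ._+_ (f≡g x) (sumℕ-cong l f≡g)

sumℕ-+ : ∀ (f g : A → ℕ) l → sumℕ (λ x → f x ℕ.+ g x) l ≡ sumℕ f l ℕ.+ sumℕ g l
sumℕ-+ f g []      = refl
sumℕ-+ f g (x ∷ l) = trans (cong ((f x ℕ.+ g x) ℕ.+_) (sumℕ-+ f g l)) (ℕ-+-interchange (f x) (g x) (sumℕ f l) (sumℕ g l))

sumℕ-const : ∀ c (l : List A) → sumℕ (λ _ → c) l ≡ length l ℕ.* c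
sumℕ-const c []      = refl
sumℕ-const c (x ∷ l) = cong (c ℕ.+_) (sumℕ-const c l)

sumℕ-≤-length : ∀ {f : A → ℕ} l → (∀ x → f x ℕ.≤ 1) → sumℕ f l ℕ.≤ length l
sumℕ-≤-length []      f≤1 = z≤n
sumℕ-≤-length (x ∷ l) f≤1 = ℕP.+-mono-≤ (f≤1 x) (sumℕ-≤-length l f≤1)

length-allFin : ∀ n → length (allFin n) ≡ n
length-allFin n = ListP.length-tabulate {n = n} id

sumℕ-tabulate : ∀ {n} (f : A → ℕ) (g : Fin n → A) → sumℕ f (tabulate g) ≡ sumℕ (f ∘ g) (allFin n)
sumℕ-tabulate {n = zero}  f g = refl
sumℕ-tabulate {n = suc n} f g =
  cong (f (g zero) ℕ.+_) (trans (sumℕ-tabulate f (g ∘ suc)) (sym (sumℕ-tabulate (f ∘ g) suc)))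

sumℕ-allFin-update : ∀ {n} (f g : Fin n → ℕ) j → (∀ i → i ≢ j → f i ≡ g i) →
  sumℕ f (allFin n) ℕ.+ g j ≡ sumℕ g (allFin n) ℕ.+ f j
sumℕ-allFin-update {suc n} f g zero f≡g
  rewrite sumℕ-tabulate f suc | sumℕ-tabulate g suc
        | sumℕ-cong (allFin n) (λ i → f≡g (suc i) λ ())
  = swap-ends (f zero) (sumℕ (g ∘ suc) (allFin n)) (g zero)
  where
  swap-ends : ∀ x y z → x ℕ.+ y ℕ.+ z ≡ z ℕ.+ y ℕ.+ x
  swap-ends = ℕ-solve-∀
sumℕ-allFin-update {suc n} f g (suc j) f≡g
  rewrite sumℕ-tabulate f suc | sumℕ-tabulate g suc | f≡g zero (λ ())
  = begin
    g zero ℕ.+ sumℕ (f ∘ suc) (allFin n) ℕ.+ g (suc j)    ≡⟨ ℕP.+-assoc (g zero) _ _ ⟩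
    g zero ℕ.+ (sumℕ (f ∘ suc) (allFin n) ℕ.+ g (suc j))  ≡⟨ cong (g zero ℕ.+_) (sumℕ-allFin-update (f ∘ suc) (g ∘ suc) j
                                                              (λ i i≢j → f≡g (suc i) (i≢j ∘ suc-injective))) ⟩
    g zero ℕ.+ (sumℕ (g ∘ suc) (allFin n) ℕ.+ f (suc j))  ≡⟨ ℕP.+-assoc (g zero) _ _ ⟨
    g zero ℕ.+ sumℕ (g ∘ suc) (allFin n) ℕ.+ f (suc j)    ∎
  where open ≡-Reasoning

𝟙[=0] 𝟙[=1] 𝟙[≥2] : ℕ → ℕ
𝟙[=0] zero = 1
𝟙[=0] (suc _) = 0
𝟙[=1] (suc zero) = 1
𝟙[=1] _ = 0
𝟙[≥2] (suc (suc _)) = 1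
𝟙[≥2] _ = 0

𝟙[=0]≤1 : ∀ k → 𝟙[=0] k ℕ.≤ 1
𝟙[=0]≤1 zero    = ℕP.≤-refl
𝟙[=0]≤1 (suc _) = z≤n

𝟙[=1]≤1 : ∀ k → 𝟙[=1] k ℕ.≤ 1
𝟙[=1]≤1 zero          = z≤n
𝟙[=1]≤1 (suc zero)    = ℕP.≤-refl
𝟙[=1]≤1 (suc (suc _)) = z≤n

byMultiplicity : ℚ → ℚ → ℚ → ℕ → ℚ
byMultiplicity v₀ v₁ v₂ zero          = v₀
byMultiplicity v₀ v₁ v₂ (suc zero)    = v₁
byMultiplicity v₀ v₁ v₂ (suc (suc _)) = v₂

byMultiplicity-linear : ∀ v₀ v₁ v₂ k →
  byMultiplicity v₀ v₁ v₂ k ≡ ℕtoℚ (𝟙[=0] k) * v₀ + ℕtoℚ (𝟙[=1] k) * v₁ + ℕtoℚ (𝟙[≥2] k) * v₂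
byMultiplicity-linear v₀ v₁ v₂ zero          = first v₀ v₁ v₂
  where
  first : ∀ x y z → x ≡ 1ℚ * x + 0ℚ * y + 0ℚ * z
  first = solve-∀ ℚ-ring
byMultiplicity-linear v₀ v₁ v₂ (suc zero)    = second v₀ v₁ v₂
  where
  second : ∀ x y z → y ≡ 0ℚ * x + 1ℚ * y + 0ℚ * z
  second = solve-∀ ℚ-ring
byMultiplicity-linear v₀ v₁ v₂ (suc (suc _)) = third v₀ v₁ v₂
  where
  third : ∀ x y z → z ≡ 0ℚ * x + 0ℚ * y + 1ℚ * z
  third = solve-∀ ℚ-ring

module _ (m : A → ℕ) where

  Σ-byMultiplicity : ∀ v₀ v₁ v₂ l → Σ (byMultiplicity v₀ v₁ v₂ ∘ m) l ≡
    ℕtoℚ (sumℕ (𝟙[=0] ∘ m) l) * v₀ + ℕtoℚ (sumℕ (𝟙[=1] ∘ m) l) * v₁ + ℕtoℚ (sumℕ (𝟙[≥2] ∘ m) l) * v₂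
  Σ-byMultiplicity v₀ v₁ v₂ l = begin
      Σ (byMultiplicity v₀ v₁ v₂ ∘ m) l
    ≡⟨ Σ-cong l (byMultiplicity-linear v₀ v₁ v₂ ∘ m) ⟩
      Σ (λ x → t₀ x + t₁ x + t₂ x) l
    ≡⟨ trans (Σ-+ (λ x → t₀ x + t₁ x) t₂ l) (cong (_+ Σ t₂ l) (Σ-+ t₀ t₁ l)) ⟩
      Σ t₀ l + Σ t₁ l + Σ t₂ l
    ≡⟨ cong₂ _+_ (cong₂ _+_ (Σ-ℕtoℚ-*ʳ (𝟙[=0] ∘ m) v₀ l) (Σ-ℕtoℚ-*ʳ (𝟙[=1] ∘ m) v₁ l))
                 (Σ-ℕtoℚ-*ʳ (𝟙[≥2] ∘ m) v₂ l) ⟩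
      ℕtoℚ (sumℕ (𝟙[=0] ∘ m) l) * v₀ + ℕtoℚ (sumℕ (𝟙[=1] ∘ m) l) * v₁ + ℕtoℚ (sumℕ (𝟙[≥2] ∘ m) l) * v₂
    ∎
    where
    open ≡-Reasoning
    t₀ t₁ t₂ : A → ℚ
    t₀ x = ℕtoℚ (𝟙[=0] (m x)) * v₀
    t₁ x = ℕtoℚ (𝟙[=1] (m x)) * v₁
    t₂ x = ℕtoℚ (𝟙[≥2] (m x)) * v₂

  sumℕ-multiplicities : ∀ l → sumℕ (𝟙[=0] ∘ m) l ℕ.+ sumℕ (𝟙[=1] ∘ m) l ℕ.+ sumℕ (𝟙[≥2] ∘ m) l ≡ length l
  sumℕ-multiplicities l = begin
      sumℕ (𝟙[=0] ∘ m) l ℕ.+ sumℕ (𝟙[=1] ∘ m) l ℕ.+ sumℕ (𝟙[≥2] ∘ m) l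
    ≡⟨ trans (sumℕ-+ (λ x → 𝟙[=0] (m x) ℕ.+ 𝟙[=1] (m x)) (𝟙[≥2] ∘ m) l)
             (cong (ℕ._+ sumℕ (𝟙[≥2] ∘ m) l) (sumℕ-+ (𝟙[=0] ∘ m) (𝟙[=1] ∘ m) l)) ⟨
      sumℕ (λ x → 𝟙[=0] (m x) ℕ.+ 𝟙[=1] (m x) ℕ.+ 𝟙[≥2] (m x)) l
    ≡⟨ sumℕ-cong l (one-class ∘ m) ⟩
      sumℕ (λ _ → 1) l
    ≡⟨ trans (sumℕ-const 1 l) (ℕP.*-identityʳ (length l)) ⟩
      length l
    ∎
    where
    open ≡-Reasoning
    one-class : ∀ k → 𝟙[=0] k ℕ.+ 𝟙[=1] k ℕ.+ 𝟙[≥2] k ≡ 1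
    one-class zero          = refl
    one-class (suc zero)    = refl
    one-class (suc (suc _)) = refl

  All-1≤⇒sumℕ-𝟙[=0]≡0 : ∀ {l} → All (λ x → 1 ℕ.≤ m x) l → sumℕ (𝟙[=0] ∘ m) l ≡ 0
  All-1≤⇒sumℕ-𝟙[=0]≡0 []                 = refl
  All-1≤⇒sumℕ-𝟙[=0]≡0 {x ∷ _} (1≤mx ∷ rest) with m x | 1≤mx
  ... | suc _ | _ = All-1≤⇒sumℕ-𝟙[=0]≡0 rest

  ¬All-1≤⇒1≤sumℕ-𝟙[=0] : ∀ l → ¬ All (λ x → 1 ℕ.≤ m x) l → 1 ℕ.≤ sumℕ (𝟙[=0] ∘ m) l
  ¬All-1≤⇒1≤sumℕ-𝟙[=0] []      ¬all = contradiction [] ¬all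
  ¬All-1≤⇒1≤sumℕ-𝟙[=0] (x ∷ l) ¬all with m x in mx≡
  ... | zero  = s≤s z≤n
  ... | suc _ = ¬All-1≤⇒1≤sumℕ-𝟙[=0] l (λ all → ¬all (subst (1 ℕ.≤_) (sym mx≡) (s≤s z≤n) ∷ all))

length-filter-≟1 : ∀ (m : A → ℕ) l → length (filter (λ x → m x ℕ.≟ 1) l) ≡ sumℕ (𝟙[=1] ∘ m) l
length-filter-≟1 m []      = refl
length-filter-≟1 m (x ∷ l) with m x
... | zero        = length-filter-≟1 m l
... | suc zero    = cong suc (length-filter-≟1 m l)
... | suc (suc _) = length-filter-≟1 m l

take-++ˡ : ∀ (xs ys : List A) {k} → k ℕ.≤ length xs → take k (xs ++ ys) ≡ take k xs
take-++ˡ xs       ys {zero}  _         = refl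
take-++ˡ (x ∷ xs) ys {suc k} (s≤s k≤) = cong (x ∷_) (take-++ˡ xs ys k≤)

<∣>-just≢nothing : ∀ (m : Maybe A) {x} → m <∣> just x ≢ nothing
<∣>-just≢nothing (just _) ()
<∣>-just≢nothing nothing  ()

-- The potential

potential : ℕ → ℕ → ℚ
potential z s = ℕtoℚ s * recip (suc z) + harmonic z

0≤potential : ∀ z s → 0ℚ ≤ potential z s
0≤potential z s = 0≤+ (0≤* (0≤ℕtoℚ s) (0≤recip (suc z))) (0≤harmonic z)

potential≤ : ∀ z s → potential z s ≤ ℕtoℚ (s ℕ.+ z)
potential≤ z s = begin
    ℕtoℚ s * recip (suc z) + harmonic z  ≤⟨ ℚP.+-mono-≤ (*-monoˡ-≤-0≤ (ℕtoℚ s) (0≤ℕtoℚ s) (recip≤1 (suc z))) (harmonic≤ℕtoℚ z) ⟩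
    ℕtoℚ s * 1ℚ + ℕtoℚ z                 ≡⟨ cong (_+ ℕtoℚ z) (ℚP.*-identityʳ (ℕtoℚ s)) ⟩
    ℕtoℚ s + ℕtoℚ z                      ≡⟨ ℕtoℚ-+ s z ⟨
    ℕtoℚ (s ℕ.+ z)                       ∎
  where open ℚP.≤-Reasoning

potential-zero : ∀ s → potential 0 s ≡ ℕtoℚ s
potential-zero s = trans (ℚP.+-identityʳ _) (ℚP.*-identityʳ (ℕtoℚ s))

-- The ring identity behind potential-balance: Z₁ = z+1, r = 1/(z+1), u = 1/(z+2), H = H_z, S⁻ = s ∸ 1.
balance-identity : ∀ Z₁ S S₁ S⁻ Q D r u H → S₁ ≡ 1ℚ + S → D ≡ Z₁ + S + Q →
  r * Z₁ ≡ 1ℚ → u * (1ℚ + Z₁) ≡ 1ℚ → S * S⁻ ≡ S * (S - 1ℚ) →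
  Z₁ * (S₁ * r + H) + S * (S⁻ * u + (H + r)) + Q * (S * u + (H + r)) ≡ (S * u + (H + r)) * D
balance-identity Z₁ S _ S⁻ Q _ r u H refl refl rZ₁≡1 u[1+Z₁]≡1 SS⁻≡ = begin
    Z₁ * ((1ℚ + S) * r + H) + S * (S⁻ * u + (H + r)) + Q * (S * u + (H + r))
  ≡⟨ expand Z₁ S S⁻ Q r u H ⟩
    R + S * (r * Z₁ - 1ℚ) - S * (u * (1ℚ + Z₁) - 1ℚ) + u * (S * S⁻ - S * (S - 1ℚ))
  ≡⟨ cong₂ (λ x y → R + S * (x - 1ℚ) - S * (y - 1ℚ) + u * (S * S⁻ - S * (S - 1ℚ))) rZ₁≡1 u[1+Z₁]≡1 ⟩
    R + S * (1ℚ - 1ℚ) - S * (1ℚ - 1ℚ) + u * (S * S⁻ - S * (S - 1ℚ))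
  ≡⟨ cong (λ x → R + S * (1ℚ - 1ℚ) - S * (1ℚ - 1ℚ) + u * (x - S * (S - 1ℚ))) SS⁻≡ ⟩
    R + S * (1ℚ - 1ℚ) - S * (1ℚ - 1ℚ) + u * (S * (S - 1ℚ) - S * (S - 1ℚ))
  ≡⟨ collapse R S u (S * (S - 1ℚ)) ⟩
    R
  ∎
  where
  open ≡-Reasoning
  R = (S * u + (H + r)) * (Z₁ + S + Q)
  expand : ∀ Z₁ S S⁻ Q r u H →
    Z₁ * ((1ℚ + S) * r + H) + S * (S⁻ * u + (H + r)) + Q * (S * u + (H + r))
    ≡ (S * u + (H + r)) * (Z₁ + S + Q) + S * (r * Z₁ - 1ℚ) - S * (u * (1ℚ + Z₁) - 1ℚ) + u * (S * S⁻ - S * (S - 1ℚ))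
  expand = solve-∀ ℚ-ring
  collapse : ∀ R S u x → R + S * (1ℚ - 1ℚ) - S * (1ℚ - 1ℚ) + u * (x - x) ≡ R
  collapse = solve-∀ ℚ-ring

-- Of the (z+1) + s + q possible next draws, z+1 hit a missing type, s a singleton and q a type
-- drawn at least twice.
potential-balance : ∀ z s q →
  ℕtoℚ (suc z) * potential z (suc s) + ℕtoℚ s * potential (suc z) (s ℕ.∸ 1) + ℕtoℚ q * potential (suc z) s
  ≡ potential (suc z) s * ℕtoℚ (suc z ℕ.+ s ℕ.+ q)
potential-balance z s q = balance-identity
  (ℕtoℚ (suc z)) (ℕtoℚ s) (ℕtoℚ (suc s)) (ℕtoℚ (s ℕ.∸ 1)) (ℕtoℚ q) (ℕtoℚ (suc z ℕ.+ s ℕ.+ q))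
  (recip (suc z)) (recip (suc (suc z))) (harmonic z)
  (ℕtoℚ-suc s)
  (trans (ℕtoℚ-+ (suc z ℕ.+ s) q) (cong (_+ ℕtoℚ q) (ℕtoℚ-+ (suc z) s)))
  (recip-inverseˡ z)
  (trans (cong (recip (suc (suc z)) *_) (sym (ℕtoℚ-suc (suc z)))) (recip-inverseˡ (suc z)))
  (ℕtoℚ-*-∸1 s)

module _ {d : ℕ} where

  count-++ : ∀ (i : Fin d) xs ys → count i (xs ++ ys) ≡ count i xs ℕ.+ count i ys
  count-++ i xs ys = trans (cong length (ListP.filter-++ (i ≟_) xs ys)) (ListP.length-++ (filter (i ≟_) xs))

  count-self : ∀ (i : Fin d) w → count i (i ∷ w) ≡ suc (count i w)
  count-self i w = cong length (ListP.filter-accept (i ≟_) refl)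

  count-other : ∀ {i j : Fin d} w → i ≢ j → count i (j ∷ w) ≡ count i w
  count-other w i≢j = cong length (ListP.filter-reject (_ ≟_) i≢j)

  count-∷ʳ-self : ∀ p (j : Fin d) → count j (p ∷ʳ j) ≡ suc (count j p)
  count-∷ʳ-self p j = trans (count-++ j p (j ∷ [])) (trans (cong (count j p ℕ.+_) (count-self j [])) (ℕP.+-comm (count j p) 1))

  count-∷ʳ-other : ∀ p {i j : Fin d} → i ≢ j → count i (p ∷ʳ j) ≡ count i p
  count-∷ʳ-other p {i} {j} i≢j =
    trans (count-++ i p (j ∷ [])) (trans (cong (count i p ℕ.+_) (count-other [] i≢j)) (ℕP.+-identityʳ (count i p)))

  missing seenOnce : List (Fin d) → ℕ
  missing  w = sumℕ (λ i → 𝟙[=0] (count i w)) (allFin d)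
  seenOnce w = sumℕ (λ i → 𝟙[=1] (count i w)) (allFin d)

  singles≡seenOnce : ∀ w → singles w ≡ seenOnce w
  singles≡seenOnce w = length-filter-≟1 (λ i → count i w) (allFin d)

  -- The truncated subtraction is exact: the sum on the right contains the term δ (count j p).
  sumℕ-count-∷ʳ : ∀ (δ : ℕ → ℕ) p j →
    sumℕ (λ i → δ (count i (p ∷ʳ j))) (allFin d) ≡ sumℕ (λ i → δ (count i p)) (allFin d) ℕ.+ δ (suc (count j p)) ℕ.∸ δ (count j p)
  sumℕ-count-∷ʳ δ p j = begin
      sumℕ after (allFin d)                                    ≡⟨ ℕP.m+n∸n≡m (sumℕ after (allFin d)) (δ (count j p)) ⟨
      sumℕ after (allFin d) ℕ.+ δ (count j p) ℕ.∸ δ (count j p)  ≡⟨ cong (ℕ._∸ δ (count j p))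
                                                                       (sumℕ-allFin-update after before j unchanged) ⟩
      sumℕ before (allFin d) ℕ.+ after j ℕ.∸ δ (count j p)       ≡⟨ cong (λ k → sumℕ before (allFin d) ℕ.+ δ k ℕ.∸ δ (count j p))
                                                                       (count-∷ʳ-self p j) ⟩
      sumℕ before (allFin d) ℕ.+ δ (suc (count j p)) ℕ.∸ δ (count j p) ∎
    where
    open ≡-Reasoning
    after before : Fin d → ℕ
    after  i = δ (count i (p ∷ʳ j))
    before i = δ (count i p)
    unchanged : ∀ i → i ≢ j → after i ≡ before i
    unchanged i i≢j = cong δ (count-∷ʳ-other p i≢j)

  covers⇒missing≡0 : ∀ {w} → covers w → missing w ≡ 0
  covers⇒missing≡0 {w} = All-1≤⇒sumℕ-𝟙[=0]≡0 (λ i → count i w)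

  ¬covers⇒1≤missing : ∀ {w} → ¬ covers w → 1 ℕ.≤ missing w
  ¬covers⇒1≤missing {w} = ¬All-1≤⇒1≤sumℕ-𝟙[=0] (λ i → count i w) (allFin d)

  missing≤d : ∀ w → missing w ℕ.≤ d
  missing≤d w = subst (missing w ℕ.≤_) (length-allFin d) (sumℕ-≤-length (allFin d) (λ i → 𝟙[=0]≤1 (count i w)))

  seenOnce≤d : ∀ w → seenOnce w ℕ.≤ d
  seenOnce≤d w = subst (seenOnce w ℕ.≤_) (length-allFin d) (sumℕ-≤-length (allFin d) (λ i → 𝟙[=1]≤1 (count i w)))

  firstCover-∷-yes : ∀ {w : List (Fin d)} {k} ks → covers (take k w) → firstCover w (k ∷ ks) ≡ just (take k w)
  firstCover-∷-yes {w} {k} ks cov with covers? (take k w)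
  ... | yes _    = refl
  ... | no ¬cov = contradiction cov ¬cov

  firstCover-∷-no : ∀ {w : List (Fin d)} {k} ks → ¬ covers (take k w) → firstCover w (k ∷ ks) ≡ firstCover w ks
  firstCover-∷-no {w} {k} ks ¬cov with covers? (take k w)
  ... | yes cov = contradiction cov ¬cov
  ... | no _    = refl

  firstCover-∷ʳ : ∀ (w : List (Fin d)) ks k → firstCover w (ks ∷ʳ k) ≡ firstCover w ks <∣> firstCover w (k ∷ [])
  firstCover-∷ʳ w []       k = refl
  firstCover-∷ʳ w (k′ ∷ ks) k with covers? (take k′ w)
  ... | yes _ = refl
  ... | no _  = firstCover-∷ʳ w ks k

  firstCover-++ : ∀ (p x : List (Fin d)) {ks} → All (ℕ._≤ length p) ks → firstCover (p ++ x) ks ≡ firstCover p ks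
  firstCover-++ p x []                 = refl
  firstCover-++ p x (_∷_ {k} k≤ ks≤) with take-++ˡ p x k≤ | covers? (take k p)
  ... | same | yes cov = trans (firstCover-∷-yes _ (subst covers (sym same) cov)) (cong just same)
  ... | same | no ¬cov = trans (firstCover-∷-no _ (¬cov ∘ subst covers same)) (firstCover-++ p x ks≤)

  firstCover-whole-yes : ∀ {w : List (Fin d)} → covers w → firstCover w (length w ∷ []) ≡ just w
  firstCover-whole-yes {w} cov = trans (firstCover-∷-yes [] (subst covers (sym take-whole) cov)) (cong just take-whole)
    where take-whole = ListP.take-all (length w) w ℕP.≤-refl

  firstCover-whole-no : ∀ {w : List (Fin d)} → ¬ covers w → firstCover w (length w ∷ []) ≡ nothing
  firstCover-whole-no {w} ¬cov = firstCover-∷-no [] (¬cov ∘ subst covers take-whole)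
    where take-whole = ListP.take-all (length w) w ℕP.≤-refl

  prefixT-split : ∀ (w : List (Fin d)) → prefixT w ≡ firstCover w (upTo (length w)) <∣> firstCover w (length w ∷ [])
  prefixT-split w = trans (cong (firstCover w) (sym (ListP.applyUpTo-∷ʳ id (length w)))) (firstCover-∷ʳ w (upTo (length w)) (length w))

  prefixT-∷ʳ : ∀ p (j : Fin d) → prefixT (p ∷ʳ j) ≡ prefixT p <∣> firstCover (p ∷ʳ j) (length (p ∷ʳ j) ∷ [])
  prefixT-∷ʳ p j = begin
      prefixT (p ∷ʳ j)                                          ≡⟨ prefixT-split (p ∷ʳ j) ⟩
      firstCover (p ∷ʳ j) (upTo (length (p ∷ʳ j))) <∣> whole    ≡⟨ cong (λ n → firstCover (p ∷ʳ j) (upTo n) <∣> whole) length-∷ʳ ⟩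
      firstCover (p ∷ʳ j) (upTo (suc (length p))) <∣> whole     ≡⟨ cong (_<∣> whole) (firstCover-++ p (j ∷ []) upTo≤) ⟩
      prefixT p <∣> whole                                       ∎
    where
    open ≡-Reasoning
    whole = firstCover (p ∷ʳ j) (length (p ∷ʳ j) ∷ [])
    length-∷ʳ : length (p ∷ʳ j) ≡ suc (length p)
    length-∷ʳ = trans (ListP.length-++ p) (ℕP.+-comm (length p) 1)
    upTo≤ : All (ℕ._≤ length p) (upTo (suc (length p)))
    upTo≤ = applyUpTo⁺₁ id (suc (length p)) ℕP.m<1+n⇒m≤n

  prefixT-∷ʳ-stopped : ∀ p (j : Fin d) {q} → prefixT p ≡ just q → prefixT (p ∷ʳ j) ≡ just q
  prefixT-∷ʳ-stopped p j stopped = trans (prefixT-∷ʳ p j) (cong (_<∣> firstCover (p ∷ʳ j) (length (p ∷ʳ j) ∷ [])) stopped)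

  prefixT≡nothing⇒¬covers : ∀ {w : List (Fin d)} → prefixT w ≡ nothing → ¬ covers w
  prefixT≡nothing⇒¬covers {w} uncovered cov = <∣>-just≢nothing (firstCover w (upTo (length w)))
    (trans (cong (firstCover w (upTo (length w)) <∣>_) (sym (firstCover-whole-yes cov))) (trans (sym (prefixT-split w)) uncovered))

  wordPotential : List (Fin d) → ℚ
  wordPotential w = potential (missing w) (seenOnce w)

  wordPotential-∷ʳ : ∀ {z} p j → missing p ≡ suc z →
    wordPotential (p ∷ʳ j) ≡
    byMultiplicity (potential z (suc (seenOnce p))) (potential (suc z) (seenOnce p ℕ.∸ 1)) (potential (suc z) (seenOnce p)) (count j p)
  wordPotential-∷ʳ {z} p j missing≡ = begin
      potential (missing (p ∷ʳ j)) (seenOnce (p ∷ʳ j))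
    ≡⟨ cong₂ potential (sumℕ-count-∷ʳ 𝟙[=0] p j) (sumℕ-count-∷ʳ 𝟙[=1] p j) ⟩
      potential (missing p ℕ.+ 0 ℕ.∸ 𝟙[=0] c) s′
    ≡⟨ cong (λ m → potential (m ℕ.+ 0 ℕ.∸ 𝟙[=0] c) s′) missing≡ ⟩
      potential (suc z ℕ.+ 0 ℕ.∸ 𝟙[=0] c) s′
    ≡⟨ by-cases c ⟩
      byMultiplicity (potential z (suc s)) (potential (suc z) (s ℕ.∸ 1)) (potential (suc z) s) c
    ∎
    where
    open ≡-Reasoning
    s = seenOnce p
    c = count j p
    s′ = s ℕ.+ 𝟙[=1] (suc c) ℕ.∸ 𝟙[=1] c
    by-cases : ∀ c → potential (suc z ℕ.+ 0 ℕ.∸ 𝟙[=0] c) (s ℕ.+ 𝟙[=1] (suc c) ℕ.∸ 𝟙[=1] c)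
                     ≡ byMultiplicity (potential z (suc s)) (potential (suc z) (s ℕ.∸ 1)) (potential (suc z) s) c
    by-cases zero          = cong₂ potential (ℕP.+-identityʳ z) (ℕP.+-comm s 1)
    by-cases (suc zero)    = cong₂ potential (cong suc (ℕP.+-identityʳ z)) (cong (ℕ._∸ 1) (ℕP.+-identityʳ s))
    by-cases (suc (suc _)) = cong₂ potential (cong suc (ℕP.+-identityʳ z)) (ℕP.+-identityʳ s)

  -- The stopped potential

  stoppedPotential : List (Fin d) → ℚ
  stoppedPotential w = maybe′ (ℕtoℚ ∘ singles) (wordPotential w) (prefixT w)

  stoppedPotential-∷ʳ-uncovered : ∀ {p} j → prefixT p ≡ nothing → stoppedPotential (p ∷ʳ j) ≡ wordPotential (p ∷ʳ j)
  stoppedPotential-∷ʳ-uncovered {p} j uncovered = by-coverage (covers? (p ∷ʳ j))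
    where
    open ≡-Reasoning
    by-coverage : Dec (covers (p ∷ʳ j)) → stoppedPotential (p ∷ʳ j) ≡ wordPotential (p ∷ʳ j)
    by-coverage (yes cov) = begin
      stoppedPotential (p ∷ʳ j)        ≡⟨ cong (maybe′ (ℕtoℚ ∘ singles) (wordPotential (p ∷ʳ j)))
                                            (trans (prefixT-∷ʳ p j) (cong₂ _<∣>_ uncovered (firstCover-whole-yes {w = p ∷ʳ j} cov))) ⟩
      ℕtoℚ (singles (p ∷ʳ j))          ≡⟨ cong ℕtoℚ (singles≡seenOnce (p ∷ʳ j)) ⟩
      ℕtoℚ (seenOnce (p ∷ʳ j))         ≡⟨ potential-zero (seenOnce (p ∷ʳ j)) ⟨
      potential 0 (seenOnce (p ∷ʳ j))  ≡⟨ cong (λ z → potential z (seenOnce (p ∷ʳ j))) (covers⇒missing≡0 {w = p ∷ʳ j} cov) ⟨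
      wordPotential (p ∷ʳ j)           ∎
    by-coverage (no ¬cov) = cong (maybe′ (ℕtoℚ ∘ singles) (wordPotential (p ∷ʳ j)))
      (trans (prefixT-∷ʳ p j) (cong₂ _<∣>_ uncovered (firstCover-whole-no {w = p ∷ʳ j} ¬cov)))

  stoppedPotential-martingale-uncovered : ∀ {p z} → prefixT p ≡ nothing → missing p ≡ suc z →
    Σ (λ j → stoppedPotential (p ∷ʳ j)) (allFin d) ≡ wordPotential p * ℕtoℚ d
  stoppedPotential-martingale-uncovered {p} {z} uncovered missing≡ = begin
      Σ (λ j → stoppedPotential (p ∷ʳ j)) (allFin d)
    ≡⟨ Σ-cong (allFin d) (λ j → trans (stoppedPotential-∷ʳ-uncovered j uncovered) (wordPotential-∷ʳ p j missing≡)) ⟩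
      Σ (byMultiplicity G₀ G₁ G₂ ∘ λ j → count j p) (allFin d)
    ≡⟨ Σ-byMultiplicity (λ j → count j p) G₀ G₁ G₂ (allFin d) ⟩
      ℕtoℚ (missing p) * G₀ + ℕtoℚ s * G₁ + ℕtoℚ n₂ * G₂
    ≡⟨ cong (λ m → ℕtoℚ m * G₀ + ℕtoℚ s * G₁ + ℕtoℚ n₂ * G₂) missing≡ ⟩
      ℕtoℚ (suc z) * G₀ + ℕtoℚ s * G₁ + ℕtoℚ n₂ * G₂
    ≡⟨ potential-balance z s n₂ ⟩
      potential (suc z) s * ℕtoℚ (suc z ℕ.+ s ℕ.+ n₂)
    ≡⟨ cong₂ (λ m n → potential m s * ℕtoℚ n) (sym missing≡) all-types ⟩
      wordPotential p * ℕtoℚ d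
    ∎
    where
    open ≡-Reasoning
    s = seenOnce p
    n₂ = sumℕ (λ j → 𝟙[≥2] (count j p)) (allFin d)
    G₀ = potential z (suc s)
    G₁ = potential (suc z) (s ℕ.∸ 1)
    G₂ = potential (suc z) s
    all-types : suc z ℕ.+ s ℕ.+ n₂ ≡ d
    all-types = trans (cong (λ m → m ℕ.+ s ℕ.+ n₂) (sym missing≡))
      (trans (sumℕ-multiplicities (λ j → count j p) (allFin d)) (length-allFin d))

  stoppedPotential-martingale : ∀ p → Σ (λ j → stoppedPotential (p ∷ʳ j)) (allFin d) ≡ stoppedPotential p * ℕtoℚ d
  stoppedPotential-martingale p = by-prefix (prefixT p) refl
    where
    open ≡-Reasoning
    by-prefix : ∀ m → prefixT p ≡ m →
      Σ (λ j → stoppedPotential (p ∷ʳ j)) (allFin d) ≡ maybe′ (ℕtoℚ ∘ singles) (wordPotential p) m * ℕtoℚ d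
    by-prefix (just q) stopped = begin
      Σ (λ j → stoppedPotential (p ∷ʳ j)) (allFin d)  ≡⟨ Σ-cong (allFin d) (λ j → cong (maybe′ (ℕtoℚ ∘ singles) (wordPotential (p ∷ʳ j)))
                                                                                   (prefixT-∷ʳ-stopped p j stopped)) ⟩
      Σ (λ _ → ℕtoℚ (singles q)) (allFin d)           ≡⟨ Σ-const (ℕtoℚ (singles q)) (allFin d) ⟩
      ℕtoℚ (singles q) * ℕtoℚ (length (allFin d))     ≡⟨ cong (λ n → ℕtoℚ (singles q) * ℕtoℚ n) (length-allFin d) ⟩
      ℕtoℚ (singles q) * ℕtoℚ d                       ∎
    by-prefix nothing uncovered =
      stoppedPotential-martingale-uncovered {p = p} uncovered (sym (ℕP.suc-pred (missing p) {{ℕ.>-nonZero 1≤missing}}))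
      where 1≤missing = ¬covers⇒1≤missing {w = p} (prefixT≡nothing⇒¬covers {w = p} uncovered)

  Σ-words-suc : ∀ (f : List (Fin d) → ℚ) n → Σ f (words d (suc n)) ≡ Σ (λ w → Σ (λ i → f (i ∷ w)) (allFin d)) (words d n)
  Σ-words-suc f n = trans (Σ-concatMap f _ (words d n)) (Σ-cong (words d n) (λ w → Σ-map f (_∷ w) (allFin d)))

  Σ-words-martingale : ∀ (f : List (Fin d) → ℚ) → (∀ p → Σ (λ j → f (p ∷ʳ j)) (allFin d) ≡ f p * ℕtoℚ d) →
    ∀ n p → Σ (λ w → f (p ++ w)) (words d n) ≡ f p * ℕtoℚ (d ℕ.^ n)
  Σ-words-martingale f martingale zero p =
    trans (ℚP.+-identityʳ _) (trans (cong f (ListP.++-identityʳ p)) (sym (ℚP.*-identityʳ (f p))))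
  Σ-words-martingale f martingale (suc n) p = begin
      Σ (λ w → f (p ++ w)) (words d (suc n))
    ≡⟨ Σ-words-suc (λ w → f (p ++ w)) n ⟩
      Σ (λ w → Σ (λ i → f (p ++ i ∷ w)) (allFin d)) (words d n)
    ≡⟨ Σ-swap (λ i w → f (p ++ i ∷ w)) (allFin d) (words d n) ⟩
      Σ (λ i → Σ (λ w → f (p ++ i ∷ w)) (words d n)) (allFin d)
    ≡⟨ Σ-cong (allFin d) (λ i → trans (Σ-cong (words d n) (λ w → cong f (sym (ListP.++-assoc p (i ∷ []) w))))
                                      (Σ-words-martingale f martingale n (p ∷ʳ i))) ⟩
      Σ (λ i → f (p ∷ʳ i) * ℕtoℚ (d ℕ.^ n)) (allFin d)
    ≡⟨ Σ-*ʳ (λ i → f (p ∷ʳ i)) (ℕtoℚ (d ℕ.^ n)) (allFin d) ⟩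
      Σ (λ i → f (p ∷ʳ i)) (allFin d) * ℕtoℚ (d ℕ.^ n)
    ≡⟨ cong (_* ℕtoℚ (d ℕ.^ n)) (martingale p) ⟩
      f p * ℕtoℚ d * ℕtoℚ (d ℕ.^ n)
    ≡⟨ ℚP.*-assoc (f p) (ℕtoℚ d) (ℕtoℚ (d ℕ.^ n)) ⟩
      f p * (ℕtoℚ d * ℕtoℚ (d ℕ.^ n))
    ≡⟨ cong (f p *_) (ℕtoℚ-* d (d ℕ.^ n)) ⟨
      f p * ℕtoℚ (d ℕ.^ suc n)
    ∎
    where open ≡-Reasoning

  residual : List (Fin d) → ℚ
  residual w = maybe′ (λ _ → 0ℚ) (wordPotential w) (prefixT w)

  JT≡maybe′ : ∀ (w : List (Fin d)) → JT w ≡ maybe′ singles 0 (prefixT w)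
  JT≡maybe′ w with prefixT w
  ... | just _  = refl
  ... | nothing = refl

  stoppedPotential≡JT+residual : ∀ w → stoppedPotential w ≡ ℕtoℚ (JT w) + residual w
  stoppedPotential≡JT+residual w = trans (by-prefix (prefixT w)) (cong (λ n → ℕtoℚ n + residual w) (sym (JT≡maybe′ w)))
    where
    by-prefix : ∀ m → maybe′ (ℕtoℚ ∘ singles) (wordPotential w) m
                      ≡ ℕtoℚ (maybe′ singles 0 m) + maybe′ (λ _ → 0ℚ) (wordPotential w) m
    by-prefix (just _) = sym (ℚP.+-identityʳ _)
    by-prefix nothing  = sym (ℚP.+-identityˡ _)

  0≤residual : ∀ w → 0ℚ ≤ residual w
  0≤residual w = by-prefix (prefixT w)
    where
    by-prefix : ∀ m → 0ℚ ≤ maybe′ (λ _ → 0ℚ) (wordPotential w) m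
    by-prefix (just _) = ℚP.≤-refl
    by-prefix nothing  = 0≤potential (missing w) (seenOnce w)

  residual≤ : ∀ w → residual w ≤ ℕtoℚ (missing w) * ℕtoℚ (d ℕ.+ d)
  residual≤ w = by-prefix (prefixT w) refl
    where
    open ℚP.≤-Reasoning
    by-prefix : ∀ m → prefixT w ≡ m → maybe′ (λ _ → 0ℚ) (wordPotential w) m ≤ ℕtoℚ (missing w) * ℕtoℚ (d ℕ.+ d)
    by-prefix (just _) _         = 0≤* (0≤ℕtoℚ (missing w)) (0≤ℕtoℚ (d ℕ.+ d))
    by-prefix nothing  uncovered = begin
        wordPotential w                     ≤⟨ potential≤ (missing w) (seenOnce w) ⟩
        ℕtoℚ (seenOnce w ℕ.+ missing w)     ≤⟨ ℕtoℚ-mono-≤ (ℕP.≤-trans (ℕP.+-mono-≤ (seenOnce≤d w) (missing≤d w))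
                                                 (ℕP.m≤n*m (d ℕ.+ d) (missing w) {{ℕ.>-nonZero 1≤missing}})) ⟩
        ℕtoℚ (missing w ℕ.* (d ℕ.+ d))      ≡⟨ ℕtoℚ-* (missing w) (d ℕ.+ d) ⟩
        ℕtoℚ (missing w) * ℕtoℚ (d ℕ.+ d)   ∎
      where 1≤missing = ¬covers⇒1≤missing {w = w} (prefixT≡nothing⇒¬covers {w = w} uncovered)

-- The error of the truncated expectation

module _ (a : ℕ) where
  private
    d : ℕ
    d = suc a

  Σ-words-absent : ∀ n (i : Fin d) → Σ (λ w → ℕtoℚ (𝟙[=0] (count i w))) (words d n) ≡ ℕtoℚ (a ℕ.^ n)
  Σ-words-absent zero    i = ℚP.+-identityʳ 1ℚ
  Σ-words-absent (suc n) i = begin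
      Σ (λ w → ℕtoℚ (𝟙[=0] (count i w))) (words d (suc n))
    ≡⟨ Σ-words-suc (λ w → ℕtoℚ (𝟙[=0] (count i w))) n ⟩
      Σ (λ w → Σ (λ j → ℕtoℚ (𝟙[=0] (count i (j ∷ w)))) (allFin d)) (words d n)
    ≡⟨ Σ-cong (words d n) (λ w → trans (Σ-ℕtoℚ (λ j → 𝟙[=0] (count i (j ∷ w))) (allFin d))
                                       (trans (cong ℕtoℚ (stays-absent w)) (ℕtoℚ-* (𝟙[=0] (count i w)) a))) ⟩
      Σ (λ w → ℕtoℚ (𝟙[=0] (count i w)) * ℕtoℚ a) (words d n)
    ≡⟨ Σ-ℕtoℚ-*ʳ (λ w → 𝟙[=0] (count i w)) (ℕtoℚ a) (words d n) ⟩
      ℕtoℚ (sumℕ (λ w → 𝟙[=0] (count i w)) (words d n)) * ℕtoℚ a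
    ≡⟨ cong (_* ℕtoℚ a) (trans (sym (Σ-ℕtoℚ (λ w → 𝟙[=0] (count i w)) (words d n))) (Σ-words-absent n i)) ⟩
      ℕtoℚ (a ℕ.^ n) * ℕtoℚ a
    ≡⟨ trans (sym (ℕtoℚ-* (a ℕ.^ n) a)) (cong ℕtoℚ (ℕP.*-comm (a ℕ.^ n) a)) ⟩
      ℕtoℚ (a ℕ.^ suc n)
    ∎
    where
    open ≡-Reasoning
    stays-absent : ∀ w → sumℕ (λ j → 𝟙[=0] (count i (j ∷ w))) (allFin d) ≡ 𝟙[=0] (count i w) ℕ.* a
    stays-absent w = ℕP.+-cancelʳ-≡ c _ _ (begin
        sumℕ after (allFin d) ℕ.+ c                   ≡⟨ sumℕ-allFin-update after (λ _ → c) i unchanged ⟩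
        sumℕ (λ _ → c) (allFin d) ℕ.+ after i          ≡⟨ cong₂ ℕ._+_ (trans (sumℕ-const c (allFin d)) (cong (ℕ._* c) (length-allFin d)))
                                                                     (cong 𝟙[=0] (count-self i w)) ⟩
        d ℕ.* c ℕ.+ 0                                  ≡⟨ rearrange a c ⟩
        c ℕ.* a ℕ.+ c                                  ∎)
      where
      c = 𝟙[=0] (count i w)
      after : Fin d → ℕ
      after j = 𝟙[=0] (count i (j ∷ w))
      unchanged : ∀ j → j ≢ i → after j ≡ c
      unchanged j j≢i = cong 𝟙[=0] (count-other w (j≢i ∘ sym))
      rearrange : ∀ a c → suc a ℕ.* c ℕ.+ 0 ≡ c ℕ.* a ℕ.+ c
      rearrange = ℕ-solve-∀

  Σ-words-missing : ∀ n → Σ (λ w → ℕtoℚ (missing w)) (words d n) ≡ ℕtoℚ (a ℕ.^ n) * ℕtoℚ d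
  Σ-words-missing n = begin
      Σ (λ w → ℕtoℚ (missing w)) (words d n)
    ≡⟨ Σ-cong (words d n) (λ w → Σ-ℕtoℚ (λ i → 𝟙[=0] (count i w)) (allFin d)) ⟨
      Σ (λ w → Σ (λ i → ℕtoℚ (𝟙[=0] (count i w))) (allFin d)) (words d n)
    ≡⟨ Σ-swap (λ i w → ℕtoℚ (𝟙[=0] (count i w))) (allFin d) (words d n) ⟩
      Σ (λ i → Σ (λ w → ℕtoℚ (𝟙[=0] (count i w))) (words d n)) (allFin d)
    ≡⟨ Σ-cong (allFin d) (Σ-words-absent n) ⟩
      Σ (λ _ → ℕtoℚ (a ℕ.^ n)) (allFin d)
    ≡⟨ Σ-const (ℕtoℚ (a ℕ.^ n)) (allFin d) ⟩
      ℕtoℚ (a ℕ.^ n) * ℕtoℚ (length (allFin d))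
    ≡⟨ cong (λ m → ℕtoℚ (a ℕ.^ n) * ℕtoℚ m) (length-allFin d) ⟩
      ℕtoℚ (a ℕ.^ n) * ℕtoℚ d
    ∎
    where open ≡-Reasoning

  Σ-words-residual≤ : ∀ n → Σ residual (words d n) ≤ ℕtoℚ (a ℕ.^ n) * ℕtoℚ d * ℕtoℚ (d ℕ.+ d)
  Σ-words-residual≤ n = begin
      Σ residual (words d n)                                   ≤⟨ Σ-mono-≤ (words d n) residual≤ ⟩
      Σ (λ w → ℕtoℚ (missing w) * ℕtoℚ (d ℕ.+ d)) (words d n)  ≡⟨ Σ-*ʳ (λ w → ℕtoℚ (missing w)) (ℕtoℚ (d ℕ.+ d)) (words d n) ⟩
      Σ (λ w → ℕtoℚ (missing w)) (words d n) * ℕtoℚ (d ℕ.+ d)  ≡⟨ cong (_* ℕtoℚ (d ℕ.+ d)) (Σ-words-missing n) ⟩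
      ℕtoℚ (a ℕ.^ n) * ℕtoℚ d * ℕtoℚ (d ℕ.+ d)                 ∎
    where open ℚP.≤-Reasoning

  stoppedPotential-[] : stoppedPotential {d} [] ≡ harmonic d
  stoppedPotential-[] = begin
      stoppedPotential {d} []                       ≡⟨ cong (maybe′ (ℕtoℚ ∘ singles {d}) (wordPotential {d} [])) prefixT-[] ⟩
      potential (missing {d} []) (seenOnce {d} [])  ≡⟨ cong₂ potential missing[] seenOnce[] ⟩
      potential d 0                                 ≡⟨ trans (cong (_+ harmonic d) (ℚP.*-zeroˡ (recip (suc d)))) (ℚP.+-identityˡ (harmonic d)) ⟩
      harmonic d                                    ∎
    where
    open ≡-Reasoning
    missing[] : missing {d} [] ≡ d
    missing[] = trans (sumℕ-const 1 (allFin d)) (trans (ℕP.*-identityʳ (length (allFin d))) (length-allFin d))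
    prefixT-[] : prefixT {d} [] ≡ nothing
    prefixT-[] = firstCover-∷-no {d} {[]} {0} [] λ { (() ∷ _) }
    seenOnce[] : seenOnce {d} [] ≡ 0
    seenOnce[] = trans (sumℕ-const 0 (allFin d)) (ℕP.*-zeroʳ (length (allFin d)))

  ∣truncatedExpectation-harmonic∣≡ : ∀ n →
    ∣ truncatedExpectation d n - harmonic d ∣ ≡ Σ residual (words d n) * recip d ^ℚ n
  ∣truncatedExpectation-harmonic∣≡ n = begin
      ∣ truncatedExpectation d n - harmonic d ∣
    ≡⟨ cong₂ (λ x y → ∣ x - y ∣) (Σ-*ʳ (ℕtoℚ ∘ JT) r (words d n)) harmonic≡ ⟩
      ∣ ΣJ * r - (ΣJ + Σresidual) * r ∣
    ≡⟨ cong ∣_∣ (difference ΣJ Σresidual r) ⟩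
      ∣ - (Σresidual * r) ∣
    ≡⟨ ℚP.∣-p∣≡∣p∣ (Σresidual * r) ⟩
      ∣ Σresidual * r ∣
    ≡⟨ ℚP.0≤p⇒∣p∣≡p (0≤* (0≤Σ (words d n) 0≤residual) (0≤^ℚ n (0≤recip d))) ⟩
      Σresidual * r
    ∎
    where
    open ≡-Reasoning
    r = recip d ^ℚ n
    ΣJ = Σ (ℕtoℚ ∘ JT) (words d n)
    Σresidual = Σ residual (words d n)
    difference : ∀ x y r → x * r - (x + y) * r ≡ - (y * r)
    difference = solve-∀ ℚ-ring
    harmonic≡ : harmonic d ≡ (ΣJ + Σresidual) * r
    harmonic≡ = begin
        harmonic d                                   ≡⟨ ℚP.*-identityʳ (harmonic d) ⟨
        harmonic d * 1ℚ                              ≡⟨ cong (harmonic d *_) (trans (ℚP.*-comm _ r) (recip^n*d^n≡1 a n)) ⟨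
        harmonic d * (ℕtoℚ (d ℕ.^ n) * r)            ≡⟨ ℚP.*-assoc (harmonic d) (ℕtoℚ (d ℕ.^ n)) r ⟨
        harmonic d * ℕtoℚ (d ℕ.^ n) * r              ≡⟨ cong (_* r) (trans (Σ-words-martingale {d} stoppedPotential stoppedPotential-martingale n [])
                                                                          (cong (_* ℕtoℚ (d ℕ.^ n)) stoppedPotential-[])) ⟨
        Σ stoppedPotential (words d n) * r           ≡⟨ cong (_* r) (trans (Σ-cong (words d n) stoppedPotential≡JT+residual)
                                                                          (Σ-+ (ℕtoℚ ∘ JT) residual (words d n))) ⟩
        (ΣJ + Σresidual) * r                         ∎

  ∣truncatedExpectation-harmonic∣*[a+n]≤ : ∀ n →
    ∣ truncatedExpectation d n - harmonic d ∣ * ℕtoℚ (a ℕ.+ n) ≤ ℕtoℚ (d ℕ.* (d ℕ.+ d) ℕ.* a)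
  ∣truncatedExpectation-harmonic∣*[a+n]≤ n = begin
      ∣ truncatedExpectation d n - harmonic d ∣ * M
    ≡⟨ cong (_* M) (∣truncatedExpectation-harmonic∣≡ n) ⟩
      Σ residual (words d n) * r * M
    ≤⟨ *-monoʳ-≤-0≤ M (0≤ℕtoℚ (a ℕ.+ n)) (*-monoʳ-≤-0≤ r 0≤r (Σ-words-residual≤ n)) ⟩
      ℕtoℚ (a ℕ.^ n) * D * D₂ * r * M
    ≡⟨ rearrange (ℕtoℚ (a ℕ.^ n)) D D₂ r M ⟩
      D * D₂ * (r * (ℕtoℚ (a ℕ.^ n) * M))
    ≡⟨ cong (λ x → D * D₂ * (r * x)) (ℕtoℚ-* (a ℕ.^ n) (a ℕ.+ n)) ⟨
      D * D₂ * (r * ℕtoℚ (a ℕ.^ n ℕ.* (a ℕ.+ n)))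
    ≤⟨ *-monoˡ-≤-0≤ (D * D₂) (0≤* (0≤ℕtoℚ d) (0≤ℕtoℚ (d ℕ.+ d)))
         (*-monoˡ-≤-0≤ r 0≤r (ℕtoℚ-mono-≤ (a^n*[a+n]≤[1+a]^n*a a n))) ⟩
      D * D₂ * (r * ℕtoℚ (d ℕ.^ n ℕ.* a))
    ≡⟨ cong (λ x → D * D₂ * (r * x)) (ℕtoℚ-* (d ℕ.^ n) a) ⟩
      D * D₂ * (r * (ℕtoℚ (d ℕ.^ n) * ℕtoℚ a))
    ≡⟨ cong (D * D₂ *_) (trans (sym (ℚP.*-assoc r _ _)) (trans (cong (_* ℕtoℚ a) (recip^n*d^n≡1 a n)) (ℚP.*-identityˡ (ℕtoℚ a)))) ⟩
      D * D₂ * ℕtoℚ a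
    ≡⟨ trans (ℕtoℚ-* (d ℕ.* (d ℕ.+ d)) a) (cong (_* ℕtoℚ a) (ℕtoℚ-* d (d ℕ.+ d))) ⟨
      ℕtoℚ (d ℕ.* (d ℕ.+ d) ℕ.* a)
    ∎
    where
    open ℚP.≤-Reasoning
    M = ℕtoℚ (a ℕ.+ n)
    D = ℕtoℚ d
    D₂ = ℕtoℚ (d ℕ.+ d)
    r = recip d ^ℚ n
    0≤r : 0ℚ ≤ r
    0≤r = 0≤^ℚ n (0≤recip d)
    rearrange : ∀ p x y r m → p * x * y * r * m ≡ x * y * (r * (p * m))
    rearrange = solve-∀ ℚ-ring

mainTheorem10 : (d : ℕ) → 1 ℕ.≤ d → (ε : ℚ) → 0ℚ < ε →
  ∃[ N ] ((n : ℕ) → N ℕ.≤ n → ∣ truncatedExpectation d n - harmonic d ∣ < ε)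
mainTheorem10 zero    ()
mainTheorem10 (suc a) _ = O[1/n]⇒eventually< (λ n → ∣ truncatedExpectation (suc a) n - harmonic (suc a) ∣)
  a (suc a ℕ.* (suc a ℕ.+ suc a) ℕ.* a) (∣truncatedExpectation-harmonic∣*[a+n]≤ a)
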